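{- Let $n$ be a positive integer such that $\sigma(n)=\sigma(n+1)$ and this common value is odd, where $\sigma(m)$ denotes the sum of the positive divisors of $m$. Then there exist integers $x,y$ such that either $n=2y^2$, $n+1=x^2$ and $x^2-2y^2=1$, or $n=x^2$, $n+1=2y^2$ and $x^2-2y^2=-1$.
   Context: $\sigma(m)=\sum_{d\mid m,\ d>0} d$ is the sum of the positive divisors of $m$. -}

module Defs where

open import Data.Nat using (ℕ; zero; suc; _+_)
open import Data.Nat.Divisibility using (_∣_; _∣?_)
open import Data.Nat.ListAction using (sum)
open import Data.List using (List; filter; upTo; map)
open import Relation.Nullary using (¬_)

-- σ m = sum of the positive divisors d of m, i.e. d ∈ {1,…,m} with d ∣ m.
-- (For m = 0 this yields 0; the statement only uses m ≥ 1.)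
σ : ℕ → ℕ
σ m = sum (filter (_∣? m) (map suc (upTo m)))

Odd : ℕ → Set
Odd m = ¬ (2 ∣ m)

module Submission where

-- If σ(n) = σ(n+1) is odd (n ≥ 1), then n and n+1 are each a square or twice
-- a square.  Two consecutive positive integers cannot both be squares, nor
-- both twice squares (parity), so one is x² and the other 2y², which gives the
-- Pell-type equation x² − 2y² = ±1.
--
-- The heart of the argument is the classical fact that σ(m) is odd only when m
-- is a square or twice a square.  Reducing modulo 2, σ(m) has the parity of
-- the number of odd divisors of m; we compute with sums valued in the
-- two-element field Parity, where x ⊕ x = 0ℙ.
--   * Doubling m does not change its odd divisors.
--   * For odd m every divisor is odd, and counting the pairs (a , b) with
--     a * b = m by rows and by diagonal (the off-diagonal pairs cancel in
--     pairs) shows that the divisor count has the parity of the number of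
--     square roots of m, so the count is odd only for squares.
-- Well-founded induction, halving even m, then finishes the characterisation.

open import Defs
open import Data.Nat using (ℕ; zero; suc; _+_; _*_; _≤_; _<_; z≤n; s≤s; z<s; s<s⁻¹; NonZero; ≢-nonZero⁻¹; parity)
open import Data.Nat.Properties
  using (_≟_; _≤?_; *-comm; *-cancelˡ-≡; *-cancelʳ-≡; *-mono-≤; m*n≢0⇒m≢0; m*n≢0⇒n≢0;
         <⇒≱; ≰⇒>; n≮n; n<1+n; n≤1+n; m<m+n; m<m*n; m+n∸n≡m; even≢odd; module ≤-Reasoning)
open import Data.Nat.Divisibility using (_∣_; _∣?_; divides; ∣-trans; ∣⇒≤; m∣m*n; n∣m*n)
open import Data.Nat.Induction using (<-wellFounded)
open import Data.Nat.ListAction using (sum)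
open import Data.Nat.Tactic.RingSolver using (solve-∀)
open import Data.Parity.Base using (Parity; 0ℙ; 1ℙ) renaming (_+_ to _⊕_; _*_ to _⊗_)
import Data.Parity.Properties as ℙ
open import Data.Integer as ℤ using (ℤ; +_; _-_; -_; _⊖_)
import Data.Integer.Properties as ℤ
open import Data.List using (filter; map; applyUpTo; upTo; _∷_)
open import Data.Bool using (if_then_else_)
open import Data.Product using (∃; ∃₂; _×_; _,_)
open import Data.Sum using (_⊎_; inj₁; inj₂)
open import Data.Empty using (⊥-elim)
open import Function using (_∘_; id; it)
open import Induction.WellFounded using (Acc; acc)
open import Relation.Nullary using (¬_; Dec; yes; no; does; contradiction)
open import Relation.Unary using (Decidable)
open import Relation.Binary.PropositionalEquality

∑< : ℕ → (ℕ → Parity) → Parity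
∑< zero    f = 0ℙ
∑< (suc n) f = f 0 ⊕ ∑< n (f ∘ suc)

∑<-cong : ∀ n {f g : ℕ → Parity} → (∀ i → f i ≡ g i) → ∑< n f ≡ ∑< n g
∑<-cong zero    f≗g = refl
∑<-cong (suc n) f≗g = cong₂ _⊕_ (f≗g 0) (∑<-cong n (f≗g ∘ suc))

∑<-zero : ∀ n {f : ℕ → Parity} → (∀ i → f i ≡ 0ℙ) → ∑< n f ≡ 0ℙ
∑<-zero zero    f≗0 = refl
∑<-zero (suc n) f≗0 = cong₂ _⊕_ (f≗0 0) (∑<-zero n (f≗0 ∘ suc))

∑<-beyond : ∀ M k {f : ℕ → Parity} → (∀ i → M ≤ i → f i ≡ 0ℙ) → ∑< (M + k) f ≡ ∑< M f
∑<-beyond zero    k f≗0 = ∑<-zero k (λ i → f≗0 i z≤n)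
∑<-beyond (suc M) k {f} f≗0 = cong (f 0 ⊕_) (∑<-beyond M k (λ i M≤i → f≗0 (suc i) (s≤s M≤i)))

∑<-distrib-⊕ : ∀ n (f g : ℕ → Parity) → ∑< n (λ i → f i ⊕ g i) ≡ ∑< n f ⊕ ∑< n g
∑<-distrib-⊕ zero    f g = refl
∑<-distrib-⊕ (suc n) f g = begin
  (f 0 ⊕ g 0) ⊕ ∑< n (λ i → f (suc i) ⊕ g (suc i))
    ≡⟨ cong ((f 0 ⊕ g 0) ⊕_) (∑<-distrib-⊕ n (f ∘ suc) (g ∘ suc)) ⟩
  (f 0 ⊕ g 0) ⊕ (∑< n (f ∘ suc) ⊕ ∑< n (g ∘ suc))
    ≡⟨ interchange (f 0) (g 0) _ _ ⟩
  (f 0 ⊕ ∑< n (f ∘ suc)) ⊕ (g 0 ⊕ ∑< n (g ∘ suc)) ∎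
  where open ≡-Reasoning
        open import Algebra.Properties.CommutativeSemigroup ℙ.+-commutativeSemigroup using (interchange)

⊕-cancel-middle : ∀ a x z → (a ⊕ x) ⊕ (x ⊕ z) ≡ a ⊕ z
⊕-cancel-middle a x z = begin
  (a ⊕ x) ⊕ (x ⊕ z)  ≡⟨ ℙ.+-assoc a x (x ⊕ z) ⟩
  a ⊕ (x ⊕ (x ⊕ z))  ≡⟨ cong (a ⊕_) (sym (ℙ.+-assoc x x z)) ⟩
  a ⊕ ((x ⊕ x) ⊕ z)  ≡⟨ cong (λ y → a ⊕ (y ⊕ z)) (ℙ.p+p≡0ℙ x) ⟩
  a ⊕ z              ∎
  where open ≡-Reasoning

-- A symmetric double sum equals its diagonal modulo 2: the terms f a b and
-- f b a with a ≠ b cancel each other.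
∑<-symmetric : ∀ n (f : ℕ → ℕ → Parity) → (∀ a b → f a b ≡ f b a) →
               ∑< n (λ a → ∑< n (f a)) ≡ ∑< n (λ a → f a a)
∑<-symmetric zero    f f-sym = refl
∑<-symmetric (suc n) f f-sym = begin
  (f 0 0 ⊕ firstRow) ⊕ ∑< n (λ a → f (suc a) 0 ⊕ ∑< n (f (suc a) ∘ suc))
    ≡⟨ cong ((f 0 0 ⊕ firstRow) ⊕_) (∑<-distrib-⊕ n (λ a → f (suc a) 0) _) ⟩
  (f 0 0 ⊕ firstRow) ⊕ (∑< n (λ a → f (suc a) 0) ⊕ ∑< n (λ a → ∑< n (f (suc a) ∘ suc)))
    ≡⟨ cong₂ (λ x y → (f 0 0 ⊕ firstRow) ⊕ (x ⊕ y))
             (∑<-cong n (λ a → f-sym (suc a) 0))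
             (∑<-symmetric n (λ a b → f (suc a) (suc b)) (λ a b → f-sym (suc a) (suc b))) ⟩
  (f 0 0 ⊕ firstRow) ⊕ (firstRow ⊕ ∑< n (λ a → f (suc a) (suc a)))
    ≡⟨ ⊕-cancel-middle (f 0 0) firstRow _ ⟩
  f 0 0 ⊕ ∑< n (λ a → f (suc a) (suc a)) ∎
  where open ≡-Reasoning
        firstRow = ∑< n (f 0 ∘ suc)

∑<-witness : ∀ n (f : ℕ → Parity) → ∑< n f ≡ 1ℙ → ∃ λ i → f i ≡ 1ℙ
∑<-witness (suc n) f sum≡1 with f 0 in f0
... | 1ℙ = 0 , f0
... | 0ℙ with ∑<-witness n (f ∘ suc) sum≡1
...   | i , fi = suc i , fi

χ : {P : Set} → Dec P → Parity
χ p = if does p then 1ℙ else 0ℙ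

χ-cong : {P Q : Set} (p : Dec P) (q : Dec Q) → (P → Q) → (Q → P) → χ p ≡ χ q
χ-cong (yes _) (yes _) P→Q Q→P = refl
χ-cong (yes x) (no ¬y) P→Q Q→P = contradiction (P→Q x) ¬y
χ-cong (no ¬x) (yes y) P→Q Q→P = contradiction (Q→P y) ¬x
χ-cong (no _)  (no _)  P→Q Q→P = refl

χ-false : {P : Set} (p : Dec P) → ¬ P → χ p ≡ 0ℙ
χ-false (yes x) ¬x = contradiction x ¬x
χ-false (no _)  ¬x = refl

χ-true⁻¹ : {P : Set} (p : Dec P) → χ p ≡ 1ℙ → P
χ-true⁻¹ (yes x) _ = x

∑<-point : ∀ n q → q < n → ∑< n (λ i → χ (i ≟ q)) ≡ 1ℙ
∑<-point (suc n) zero    _   = cong (1ℙ ⊕_) (∑<-zero n (λ _ → refl))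
∑<-point (suc n) (suc q) q<n = ∑<-point n q (s<s⁻¹ q<n)

even⇒2∣ : ∀ n → parity n ≡ 0ℙ → 2 ∣ n
even⇒2∣ zero          _      = divides 0 refl
even⇒2∣ (suc (suc n)) even-n with even⇒2∣ n even-n
... | divides q refl = divides (suc q) refl

2∣⇒even : ∀ {n} → 2 ∣ n → parity n ≡ 0ℙ
2∣⇒even (divides q refl) = trans (ℙ.*-homo-* q 2) (ℙ.*-zeroʳ (parity q))

Odd⇒parity : ∀ n → Odd n → parity n ≡ 1ℙ
Odd⇒parity n odd-n with parity n in parity-n
... | 0ℙ = contradiction (even⇒2∣ n parity-n) odd-n
... | 1ℙ = refl

divisor-of-odd : ∀ {d m} → parity m ≡ 1ℙ → d ∣ m → parity d ≡ 1ℙ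
divisor-of-odd {d} odd-m d∣m with parity d in parity-d
... | 1ℙ = refl
... | 0ℙ with () ← trans (sym (2∣⇒even (∣-trans (even⇒2∣ d parity-d) d∣m))) odd-m

-- An odd divisor of h * 2 divides h: in h * 2 = q * d the cofactor q is even.
odd-divisor-of-double : ∀ {d} h → parity d ≡ 1ℙ → d ∣ h * 2 → d ∣ h
odd-divisor-of-double {d} h odd-d (divides q h*2≡q*d)
  with even⇒2∣ q even-q
  where
  even-q : parity q ≡ 0ℙ
  even-q = begin
    parity q             ≡⟨ sym (ℙ.*-identityʳ (parity q)) ⟩
    parity q ⊗ 1ℙ        ≡⟨ cong (parity q ⊗_) (sym odd-d) ⟩
    parity q ⊗ parity d  ≡⟨ sym (ℙ.*-homo-* q d) ⟩
    parity (q * d)       ≡⟨ cong parity (sym h*2≡q*d) ⟩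
    parity (h * 2)       ≡⟨ 2∣⇒even (n∣m*n h) ⟩
    0ℙ                   ∎
    where open ≡-Reasoning
... | divides k refl = divides k (*-cancelʳ-≡ h (k * d) 2 (trans h*2≡q*d (regroup k d)))
  where
  regroup : ∀ k d → k * 2 * d ≡ k * d * 2
  regroup = solve-∀

oddDivisor : ℕ → ℕ → Parity
oddDivisor m d = χ (d ∣? m) ⊗ parity d

oddDivisorCount : ℕ → Parity
oddDivisorCount m = ∑< (suc m) (oddDivisor m)

map-applyUpTo : ∀ (g f : ℕ → ℕ) n → map g (applyUpTo f n) ≡ applyUpTo (g ∘ f) n
map-applyUpTo g f zero    = refl
map-applyUpTo g f (suc n) = cong (g (f 0) ∷_) (map-applyUpTo g (f ∘ suc) n)

parity-sum-filter : ∀ {P : ℕ → Set} (P? : Decidable P) (f : ℕ → ℕ) n →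
  parity (sum (filter P? (applyUpTo f n))) ≡ ∑< n (λ i → χ (P? (f i)) ⊗ parity (f i))
parity-sum-filter P? f zero = refl
parity-sum-filter P? f (suc n) with P? (f 0)
... | yes _ = trans (ℙ.+-homo-+ (f 0) _) (cong (parity (f 0) ⊕_) (parity-sum-filter P? (f ∘ suc) n))
... | no  _ = parity-sum-filter P? (f ∘ suc) n

parity-σ : ∀ m → parity (σ m) ≡ oddDivisorCount m
parity-σ m = begin
  parity (sum (filter (_∣? m) (map suc (upTo m))))
    ≡⟨ cong (λ ds → parity (sum (filter (_∣? m) ds))) (map-applyUpTo suc id m) ⟩
  parity (sum (filter (_∣? m) (applyUpTo suc m)))
    ≡⟨ parity-sum-filter (_∣? m) suc m ⟩
  ∑< m (oddDivisor m ∘ suc)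
    ≡⟨ cong (_⊕ ∑< m (oddDivisor m ∘ suc)) (sym (ℙ.*-zeroʳ (χ (0 ∣? m)))) ⟩
  oddDivisorCount m ∎
  where open ≡-Reasoning

oddDivisor-double : ∀ h d → oddDivisor (h * 2) d ≡ oddDivisor h d
oddDivisor-double h d with parity d in parity-d
... | 0ℙ = trans (ℙ.*-zeroʳ (χ (d ∣? h * 2))) (sym (ℙ.*-zeroʳ (χ (d ∣? h))))
... | 1ℙ = cong (_⊗ 1ℙ) (χ-cong (d ∣? h * 2) (d ∣? h)
                          (odd-divisor-of-double h parity-d) (λ d∣h → ∣-trans d∣h (m∣m*n 2)))

oddDivisor-beyond : ∀ m .{{_ : NonZero m}} d → suc m ≤ d → oddDivisor m d ≡ 0ℙ
oddDivisor-beyond m d m<d with d ∣? m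
... | yes d∣m = contradiction (∣⇒≤ d∣m) (<⇒≱ m<d)
... | no  _   = refl

oddDivisorCount-double : ∀ h .{{_ : NonZero h}} → oddDivisorCount (h * 2) ≡ oddDivisorCount h
oddDivisorCount-double h = begin
  ∑< (suc (h * 2)) (oddDivisor (h * 2)) ≡⟨ ∑<-cong (suc (h * 2)) (oddDivisor-double h) ⟩
  ∑< (suc (h * 2)) (oddDivisor h)       ≡⟨ cong (λ n → ∑< n (oddDivisor h)) (range h) ⟩
  ∑< (suc h + h) (oddDivisor h)         ≡⟨ ∑<-beyond (suc h) h (oddDivisor-beyond h) ⟩
  ∑< (suc h) (oddDivisor h)             ∎
  where open ≡-Reasoning
        range : ∀ h → suc (h * 2) ≡ suc h + h
        range = solve-∀

divides-as-count : ∀ m .{{_ : NonZero m}} a → χ (a ∣? m) ≡ ∑< (suc m) (λ b → χ (a * b ≟ m))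
divides-as-count m a with a ∣? m
... | no ¬a∣m = sym (∑<-zero (suc m) (λ b → χ-false (a * b ≟ m) (¬a∣m ∘ cofactor b)))
  where cofactor : ∀ b → a * b ≡ m → a ∣ m
        cofactor b a*b≡m = divides b (trans (sym a*b≡m) (*-comm a b))
... | yes (divides q m≡q*a) = sym (begin
  ∑< (suc m) (λ b → χ (a * b ≟ m))
    ≡⟨ ∑<-cong (suc m) (λ b → χ-cong (a * b ≟ m) (b ≟ q) cancel (λ { refl → ab≡m })) ⟩
  ∑< (suc m) (λ b → χ (b ≟ q))
    ≡⟨ ∑<-point (suc m) q (s≤s (∣⇒≤ (divides a (trans m≡q*a (*-comm q a))))) ⟩
  1ℙ ∎)
  where
  open ≡-Reasoning
  ab≡m : a * q ≡ m
  ab≡m = trans (*-comm a q) (sym m≡q*a)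
  instance
    a≢0 : NonZero a
    a≢0 = m*n≢0⇒n≢0 q {{subst NonZero m≡q*a it}}
  cancel : ∀ {b} → a * b ≡ m → b ≡ q
  cancel {b} a*b≡m = *-cancelˡ-≡ b q a (trans a*b≡m (sym ab≡m))

oddDivisorCount-odd : ∀ m .{{_ : NonZero m}} → parity m ≡ 1ℙ →
                      oddDivisorCount m ≡ ∑< (suc m) (λ a → χ (a * a ≟ m))
oddDivisorCount-odd m odd-m = begin
  ∑< (suc m) (oddDivisor m)                          ≡⟨ ∑<-cong (suc m) all-divisors-odd ⟩
  ∑< (suc m) (λ a → χ (a ∣? m))                      ≡⟨ ∑<-cong (suc m) (divides-as-count m) ⟩
  ∑< (suc m) (λ a → ∑< (suc m) (λ b → χ (a * b ≟ m))) ≡⟨ ∑<-symmetric (suc m) _ swap ⟩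
  ∑< (suc m) (λ a → χ (a * a ≟ m))                   ∎
  where
  open ≡-Reasoning
  all-divisors-odd : ∀ d → oddDivisor m d ≡ χ (d ∣? m)
  all-divisors-odd d with d ∣? m
  ... | yes d∣m = divisor-of-odd odd-m d∣m
  ... | no  _   = refl
  swap : ∀ a b → χ (a * b ≟ m) ≡ χ (b * a ≟ m)
  swap a b = χ-cong (a * b ≟ m) (b * a ≟ m) (trans (*-comm b a)) (trans (*-comm a b))

odd-square : ∀ m .{{_ : NonZero m}} → parity m ≡ 1ℙ → oddDivisorCount m ≡ 1ℙ → ∃ λ s → m ≡ s * s
odd-square m odd-m count≡1
  with s , χ≡1 ← ∑<-witness (suc m) _ (trans (sym (oddDivisorCount-odd m odd-m)) count≡1)
  = s , sym (χ-true⁻¹ (s * s ≟ m) χ≡1)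

SquareOrTwiceSquare : ℕ → Set
SquareOrTwiceSquare m = ∃ λ s → m ≡ s * s ⊎ m ≡ 2 * (s * s)

double-SquareOrTwiceSquare : ∀ h → SquareOrTwiceSquare h → SquareOrTwiceSquare (h * 2)
double-SquareOrTwiceSquare h (s , inj₁ refl) = s , inj₂ (*-comm (s * s) 2)
double-SquareOrTwiceSquare h (s , inj₂ refl) = 2 * s , inj₁ (twice-twice s)
  where twice-twice : ∀ s → 2 * (s * s) * 2 ≡ 2 * s * (2 * s)
        twice-twice = solve-∀

odd-count⇒SquareOrTwiceSquare : ∀ m → Acc _<_ m → .{{_ : NonZero m}} →
  oddDivisorCount m ≡ 1ℙ → SquareOrTwiceSquare m
odd-count⇒SquareOrTwiceSquare m (acc smaller) count≡1 with parity m in parity-m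
... | 1ℙ with s , m≡s*s ← odd-square m parity-m count≡1 = s , inj₁ m≡s*s
... | 0ℙ with divides h refl ← even⇒2∣ m parity-m =
  double-SquareOrTwiceSquare h
    (odd-count⇒SquareOrTwiceSquare h (smaller (m<m*n h 2 (s≤s (s≤s z≤n))))
      (trans (sym (oddDivisorCount-double h)) count≡1))
  where instance
    h≢0 : NonZero h
    h≢0 = m*n≢0⇒m≢0 h

odd-σ⇒SquareOrTwiceSquare : ∀ m .{{_ : NonZero m}} → Odd (σ m) → SquareOrTwiceSquare m
odd-σ⇒SquareOrTwiceSquare m odd-σ =
  odd-count⇒SquareOrTwiceSquare m (<-wellFounded m) (trans (sym (parity-σ m)) (Odd⇒parity (σ m) odd-σ))

-- 0 is the only square followed by a square: for s > 0, s² < s² + 1 < (s + 1)².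
consecutive-squares : ∀ s r → suc (s * s) ≡ r * r → s ≡ 0
consecutive-squares zero      r _ = refl
consecutive-squares s@(suc _) r s²+1≡r² with r ≤? s
... | yes r≤s = ⊥-elim (n≮n (s * s) (begin-strict
  s * s      <⟨ n<1+n (s * s) ⟩
  suc (s * s) ≡⟨ s²+1≡r² ⟩
  r * r       ≤⟨ *-mono-≤ r≤s r≤s ⟩
  s * s       ∎))
  where open ≤-Reasoning
... | no r≰s = ⊥-elim (n≮n (suc (s * s)) (begin-strict
  suc (s * s)               <⟨ m<m+n (suc (s * s)) z<s ⟩
  suc (s * s) + (s + s)     ≡⟨ expand s ⟩
  suc s * suc s             ≤⟨ *-mono-≤ (≰⇒> r≰s) (≰⇒> r≰s) ⟩
  r * r                     ≡⟨ s²+1≡r² ⟨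
  suc (s * s)               ∎))
  where open ≤-Reasoning
        expand : ∀ s → suc (s * s) + (s + s) ≡ suc s * suc s
        expand = solve-∀

ℤ-square : ∀ s → + (s * s) ≡ + s ℤ.* + s
ℤ-square s = ℤ.pos-* s s

ℤ-twiceSquare : ∀ s → + (2 * (s * s)) ≡ + 2 ℤ.* (+ s ℤ.* + s)
ℤ-twiceSquare s = trans (ℤ.pos-* 2 (s * s)) (cong (+ 2 ℤ.*_) (ℤ-square s))

suc⊖ : ∀ n → suc n ⊖ n ≡ + 1
suc⊖ n = trans (ℤ.⊖-≥ (n≤1+n n)) (cong +_ (m+n∸n≡m 1 n))

first-alternative : ∀ {n} s r → n ≡ 2 * (s * s) → suc n ≡ r * r →
  (+ n ≡ + 2 ℤ.* (+ s ℤ.* + s)) × (+ suc n ≡ + r ℤ.* + r) ×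
  (+ r ℤ.* + r - + 2 ℤ.* (+ s ℤ.* + s) ≡ + 1)
first-alternative {n} s r refl n+1≡r² = ℤ-twiceSquare s , n+1≡ , (begin
  + r ℤ.* + r - + 2 ℤ.* (+ s ℤ.* + s) ≡⟨ cong₂ _-_ n+1≡ (ℤ-twiceSquare s) ⟨
  + suc n - + n                       ≡⟨ ℤ.[+m]-[+n]≡m⊖n (suc n) n ⟩
  suc n ⊖ n                           ≡⟨ suc⊖ n ⟩
  + 1                                 ∎)
  where open ≡-Reasoning
        n+1≡ : + suc n ≡ + r ℤ.* + r
        n+1≡ = trans (cong +_ n+1≡r²) (ℤ-square r)

second-alternative : ∀ {n} s r → n ≡ s * s → suc n ≡ 2 * (r * r) →
  (+ n ≡ + s ℤ.* + s) × (+ suc n ≡ + 2 ℤ.* (+ r ℤ.* + r)) ×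
  (+ s ℤ.* + s - + 2 ℤ.* (+ r ℤ.* + r) ≡ - + 1)
second-alternative {n} s r refl n+1≡2r² = ℤ-square s , n+1≡ , (begin
  + s ℤ.* + s - + 2 ℤ.* (+ r ℤ.* + r) ≡⟨ cong₂ _-_ (ℤ-square s) n+1≡ ⟨
  + n - + suc n                       ≡⟨ ℤ.[+m]-[+n]≡m⊖n n (suc n) ⟩
  n ⊖ suc n                           ≡⟨ ℤ.⊖-swap n (suc n) ⟩
  - (suc n ⊖ n)                       ≡⟨ cong -_ (suc⊖ n) ⟩
  - + 1                               ∎)
  where open ≡-Reasoning
        n+1≡ : + suc n ≡ + 2 ℤ.* (+ r ℤ.* + r)
        n+1≡ = trans (cong +_ n+1≡2r²) (ℤ-twiceSquare r)

theorem3 : (n : ℕ) → NonZero n → σ n ≡ σ (suc n) → Odd (σ n) →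
    ∃₂ λ (x y : ℤ) →
    ((+ n ≡ + 2 ℤ.* (y ℤ.* y)) × (+ suc n ≡ x ℤ.* x) × (x ℤ.* x - + 2 ℤ.* (y ℤ.* y) ≡ + 1))
    ⊎ ((+ n ≡ x ℤ.* x) × (+ suc n ≡ + 2 ℤ.* (y ℤ.* y)) × (x ℤ.* x - + 2 ℤ.* (y ℤ.* y) ≡ - + 1))
theorem3 n n≢0 σ-equal odd-σ
  with odd-σ⇒SquareOrTwiceSquare n {{n≢0}} odd-σ
     | odd-σ⇒SquareOrTwiceSquare (suc n) (subst Odd σ-equal odd-σ)
... | s , inj₁ n≡s² | r , inj₁ n+1≡r² =
  contradiction (subst (λ t → n ≡ t * t) (consecutive-squares s r (trans (cong suc (sym n≡s²)) n+1≡r²)) n≡s²)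
                (≢-nonZero⁻¹ n {{n≢0}})
... | s , inj₂ n≡2s² | r , inj₂ n+1≡2r² =
  contradiction (trans (sym n+1≡2r²) (cong suc n≡2s²)) (even≢odd (r * r) (s * s))
... | s , inj₂ n≡2s² | r , inj₁ n+1≡r²  = + r , + s , inj₁ (first-alternative s r n≡2s² n+1≡r²)
... | s , inj₁ n≡s²  | r , inj₂ n+1≡2r² = + s , + r , inj₂ (second-alternative s r n≡s² n+1≡2r²)
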